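{- For $n\geq 1$ define \[ d_n=\prod_{p\ \text{prime},\ p<n} p^{\max\{t:\ p^t\leq s_p(n)\}}, \] where $s_p(n)=\alpha_0+\alpha_1+\dots+\alpha_r$ is the sum of the digits in the base-$p$ expansion $n=\alpha_0+\alpha_1p+\dots+\alpha_rp^r$. Let $H=\log(\mathrm{e}^{A}\mathrm{e}^{B})\in\mathbb{Q}\langle\langle A,B\rangle\rangle$ be the Baker--Campbell--Hausdorff series. Then for every $n\geq 1$ and every word $w\in\{A,B\}^n$ of length $n$, \[ \mathrm{denom}(\mathrm{coeff}(w,H))\ \big|\ n!\,d_n . \]
   Context: $\mathbb{Q}\langle\langle A,B\rangle\rangle$ is the ring of formal power series in non-commuting variables $A,B$ with rational coefficients, and $H=\log(\mathrm{e}^{A}\mathrm{e}^{B})=\sum_{k\geq1}\frac{(-1)^{k+1}}{k}(\mathrm{e}^{A}\mathrm{e}^{B}-1)^k$, where $\mathrm{e}^{X}=\sum_{m\ge0}X^m/m!$. $\{A,B\}^n$ is the set of words of length $n$ over the alphabet $\{A,B\}$; for a series $X$ and a word $w$, $\mathrm{coeff}(w,X)\in\mathbb{Q}$ is the coefficient of $w$ in $X$. For $r\in\mathbb{Q}$, $\mathrm{denom}(r)$ is the smallest positive integer $d$ with $rd\in\mathbb{Z}$ (so $\mathrm{denom}(0)=1$). -}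

module Defs where

open import Data.Nat as ℕ using (ℕ; zero; suc; _^_; _≤?_; _∸_; _!)
open import Data.Nat.Properties using (_!≢0)
open import Data.Nat.Primality using (prime?)
open import Data.Digit using (toNatDigits)
open import Data.Integer as ℤ using (ℤ; +_)
open import Data.Rational as ℚ using (ℚ; 0ℚ; 1ℚ; _+_; _*_; _-_; -_)
open import Data.List using (List; []; _∷_; length; map; filter; upTo; foldr; _++_)
open import Data.Nat.ListAction using (sum; product)
open import Data.Product using (_×_; _,_)

data Letter : Set where
  A B : Letter

Word : Set
Word = List Letter

-- Q<<A,B>>: a formal series is its coefficient function on words
Series : Set
Series = Word → ℚ

coeff : Word → Series → ℚ
coeff w X = X w

Σℚ : List ℚ → ℚ
Σℚ = foldr _+_ 0ℚ

splits : Word → List (Word × Word)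
splits [] = ([] , []) ∷ []
splits (x ∷ w) = ([] , x ∷ w) ∷ map (λ { (u , v) → (x ∷ u , v) }) (splits w)

oneS : Series
oneS [] = 1ℚ
oneS (_ ∷ _) = 0ℚ

letterS : Letter → Series
letterS a (b ∷ []) with a | b
... | A | A = 1ℚ
... | B | B = 1ℚ
... | _ | _ = 0ℚ
letterS a _ = 0ℚ

_⊖_ : Series → Series → Series
(X ⊖ Y) w = X w - Y w

_⊛_ : Series → Series → Series
(X ⊛ Y) w = Σℚ (map (λ { (u , v) → X u * Y v }) (splits w))

powS : Series → ℕ → Series
powS X zero = oneS
powS X (suc m) = X ⊛ powS X m

inv : ℕ → ℚ
inv zero = 0ℚ
inv (suc m) = ℚ._/_ (+ 1) (suc m)

-- e^X = Σ_{m≥0} X^m / m!, for X with zero constant term.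
-- The coefficient of a word w of length n only receives contributions
-- from m ≤ n (X^m has no words of length < m), so the sum is finite.
expS : Series → Series
expS X w = Σℚ (map (λ m → ℚ._/_ (+ 1) (m !) {{m !≢0}} * powS X m w) (upTo (suc (length w))))

-- log(1 + Y) = Σ_{k≥1} (-1)^{k+1}/k Y^k, for Y with zero constant term
-- (again only k ≤ length w contribute to the coefficient of w).
sgn : ℕ → ℚ
sgn zero = 1ℚ
sgn (suc k) = - sgn k

log1p : Series → Series
log1p Y w = Σℚ (map (λ k → sgn k * inv (suc k) * powS Y (suc k) w) (upTo (length w)))

H : Series
H = log1p ((expS (letterS A) ⊛ expS (letterS B)) ⊖ oneS)

denom : ℚ → ℕ
denom r = ℚ.↧ₙ r

digitSum : ℕ → ℕ → ℕ
digitSum (suc (suc k)) n = sum (toNatDigits (suc (suc k)) n)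
digitSum _ n = n

maxExp : ℕ → ℕ → ℕ
maxExp p s = foldr ℕ._⊔_ 0 (filter (λ t → p ^ t ≤? s) (upTo (suc s)))

d : ℕ → ℕ
d n = product (map (λ p → p ^ maxExp p (digitSum p n)) (filter prime? (upTo n)))

module Submission where

-- Write P = e^A e^B − 1, so that H = Σ_{j≥1} (−1)^(j+1) P^j / j. Since |u|! · P(u) is a
-- natural number for every word u (a sum of binomial coefficients), n! · P^j(w) is, for
-- a word w of length n, a natural combination of multinomial coefficients
-- n! / (l₁! ⋯ l_j!) with all lᵢ ≥ 1. By Kummer's formula the p-adic valuation of such a
-- coefficient is (Σ s_p(lᵢ) − s_p(n)) / (p − 1) ≥ (j − s_p(n)) / (p − 1). Hence j divides
-- d_n · n! · P^j(w): for p^e ∣ j, the factor p^t of d_n satisfies s_p(n) < p^(t+1), and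
-- when t < e the missing p^(e−t) is supplied by that valuation bound because p^e ≤ j.

module NumberTheory where

  open import Data.Bool.Base using (true; false)
  open import Data.Digit using (toNatDigits)
  open import Data.Empty using (⊥-elim)
  open import Data.List.Base using (List; []; _∷_; foldr)
  open import Data.List.Membership.Propositional using (_∈_)
  open import Data.List.Membership.Propositional.Properties using (∈-map⁺; ∈-filter⁺; ∈-upTo⁺)
  open import Data.List.Relation.Unary.Any using (here; there)
  open import Data.Nat.ListAction.Properties using (∈⇒∣product)
  open import Data.Nat.Base
  open import Data.Nat.DivMod
  open import Data.Nat.Divisibility
  open import Data.Nat.Induction using (<-wellFounded-fast)
  open import Data.Nat.ListAction using (sum)
  open import Data.Nat.Properties
  open import Data.Product.Base using (∃-syntax; _×_; _,_)
  open import Induction.WellFounded using (Acc; acc)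
  open import Relation.Binary.PropositionalEquality
  open import Function.Base using (_∘_)
  open import Relation.Nullary using (¬_; does; yes; no)
  open import Data.Nat.Primality using (Prime; prime?; euclidsLemma; prime⇒nonZero; prime⇒irreducible)
  open import Data.Nat.Primality.Factorisation using (factorise)
  open import Data.Nat.Coprimality using (Coprime; coprime-divisor)
  import Data.List.Relation.Unary.All as All
  open import Data.Nat.Tactic.RingSolver using (solve-∀)
  open import Data.Sum.Base using (inj₁; inj₂)

  open import Defs

  -- Digit sums

  -- `toNatDigits` is computed by a local helper that cannot be referred to by name.
  -- Checking `digitsFrom-solution` solves the metavariable `digitsFrom` to that
  -- helper, taken with the outer argument N and an arbitrary accumulator.
  mutual
    digitsFrom : (k n : ℕ) {m : ℕ} → Acc _<_ m → List ℕ → List ℕ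
    digitsFrom = _

    digitsFrom-solution : (k n : ℕ) → toNatDigits (2+ k) n ≡ toNatDigits (2+ k) n
    digitsFrom-solution k n with <-wellFounded-fast n
    digitsFrom-solution k zero    | _ = refl
    digitsFrom-solution k (suc n) | acc rs with does (0 <? suc n / 2+ k)
    ... | false = refl
    ... | true with suc n / 2+ k | rs (m/n<m (suc n) (2+ k) sz<ss) | suc n % 2+ k ∷ []
    ... | m | a | xs with suc n
    ... | N = refl {x = digitsFrom k N a xs}

  module _ (k : ℕ) where

    digitsFrom-irrelevant : (N N′ : ℕ) {m : ℕ} (a a′ : Acc _<_ m) (xs : List ℕ) →
                            digitsFrom k N a xs ≡ digitsFrom k N′ a′ xs
    digitsFrom-irrelevant N N′ {zero}  a        a′        xs = refl
    digitsFrom-irrelevant N N′ {suc m} (acc rs) (acc rs′) xs with does (0 <? suc m / 2+ k)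
    ... | false = refl
    ... | true  = digitsFrom-irrelevant N N′ (rs lt) (rs′ lt) (suc m % 2+ k ∷ xs)
      where lt = m/n<m (suc m) (2+ k) sz<ss

    sum-digitsFrom : (N : ℕ) {m : ℕ} (a : Acc _<_ m) (xs : List ℕ) →
                     sum (digitsFrom k N a xs) ≡ sum (digitsFrom k N a []) + sum xs
    sum-digitsFrom N {zero}  a        xs = refl
    sum-digitsFrom N {suc m} (acc rs) xs with does (0 <? suc m / 2+ k)
    ... | false = cong (_+ sum xs) (sym (+-identityʳ (suc m % 2+ k)))
    ... | true  = begin
      sum (digitsFrom k N (rs lt) (r ∷ xs))              ≡⟨ sum-digitsFrom N (rs lt) (r ∷ xs) ⟩
      sum (digitsFrom k N (rs lt) []) + (r + sum xs)     ≡⟨ regroup (sum (digitsFrom k N (rs lt) [])) r (sum xs) ⟩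
      sum (digitsFrom k N (rs lt) []) + (r + 0) + sum xs ≡⟨ cong (_+ sum xs) (sum-digitsFrom N (rs lt) (r ∷ [])) ⟨
      sum (digitsFrom k N (rs lt) (r ∷ [])) + sum xs     ∎
      where
      open ≡-Reasoning
      r  = suc m % 2+ k
      lt = m/n<m (suc m) (2+ k) sz<ss
      regroup : ∀ s r x → s + (r + x) ≡ s + (r + 0) + x
      regroup = solve-∀

    digitSum-divMod : ∀ n → digitSum (2+ k) n ≡ n % 2+ k + digitSum (2+ k) (n / 2+ k)
    digitSum-divMod zero    = refl
    digitSum-divMod (suc n) = unfold (<-wellFounded-fast (suc n)) (<-wellFounded-fast (suc n / 2+ k))
      where
      unfold : (a : Acc _<_ (suc n)) (a′ : Acc _<_ (suc n / 2+ k)) →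
               sum (digitsFrom k (suc n) a []) ≡ suc n % 2+ k + sum (digitsFrom k (suc n / 2+ k) a′ [])
      unfold (acc rs) a′ with does (0 <? suc n / 2+ k) in quotient>0
      ... | false with suc n / 2+ k
      ...   | zero = refl
      unfold (acc rs) a′ | false | suc _ with () ← quotient>0
      unfold (acc rs) a′ | true = begin
        sum (digitsFrom k (suc n) a″ (r ∷ []))     ≡⟨ sum-digitsFrom (suc n) a″ (r ∷ []) ⟩
        sum (digitsFrom k (suc n) a″ []) + (r + 0) ≡⟨ cong₂ _+_ (cong sum (digitsFrom-irrelevant (suc n) (suc n / 2+ k) a″ a′ [])) (+-identityʳ r) ⟩
        sum (digitsFrom k (suc n / 2+ k) a′ []) + r  ≡⟨ +-comm _ r ⟩
        r + sum (digitsFrom k (suc n / 2+ k) a′ []) ∎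
        where
        open ≡-Reasoning
        r  = suc n % 2+ k
        a″ = rs (m/n<m (suc n) (2+ k) sz<ss)

    digitSum-+* : ∀ {r} q → r < 2+ k → digitSum (2+ k) (r + q * 2+ k) ≡ r + digitSum (2+ k) q
    digitSum-+* {r} q r<b = begin
      digitSum (2+ k) n                         ≡⟨ digitSum-divMod n ⟩
      n % 2+ k + digitSum (2+ k) (n / 2+ k)      ≡⟨ cong₂ (λ x y → x + digitSum (2+ k) y) n%b≡r n/b≡q ⟩
      r + digitSum (2+ k) q                     ∎
      where
      open ≡-Reasoning
      n = r + q * 2+ k
      n%b≡r : n % 2+ k ≡ r
      n%b≡r = trans ([m+kn]%n≡m%n r q (2+ k)) (m<n⇒m%n≡m r<b)
      n/b≡q : n / 2+ k ≡ q
      n/b≡q = begin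
        n / 2+ k                      ≡⟨ +-distrib-/-∣ʳ r (divides-refl q) ⟩
        r / 2+ k + q * 2+ k / 2+ k    ≡⟨ cong₂ _+_ (m<n⇒m/n≡0 r<b) (m*n/n≡m q (2+ k)) ⟩
        q                             ∎

  -- Valuations

  ^-monoʳ-∣ : ∀ b {e v} → e ≤ v → b ^ e ∣ b ^ v
  ^-monoʳ-∣ b {e} {v} e≤v = divides (b ^ (v ∸ e)) (begin
    b ^ v                ≡⟨ cong (b ^_) (m+[n∸m]≡n e≤v) ⟨
    b ^ (e + (v ∸ e))    ≡⟨ ^-distribˡ-+-* b e (v ∸ e) ⟩
    b ^ e * b ^ (v ∸ e)  ≡⟨ *-comm (b ^ e) (b ^ (v ∸ e)) ⟩
    b ^ (v ∸ e) * b ^ e  ∎)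
    where open ≡-Reasoning

  record Valuation (p x a : ℕ) : Set where
    constructor valuation
    field
      cofactor     : ℕ
      ∤cofactor    : ¬ p ∣ cofactor
      factorisation : x ≡ p ^ a * cofactor

  valuation-exists : ∀ k x .{{_ : NonZero x}} → ∃[ a ] Valuation (2+ k) x a
  valuation-exists k x = go x (<-wellFounded-fast x)
    where
    go : ∀ x → Acc _<_ x → .{{NonZero x}} → ∃[ a ] Valuation (2+ k) x a
    go x (acc rs) with 2+ k ∣? x
    ... | no  b∤x = 0 , valuation x b∤x (sym (*-identityˡ x))
    ... | yes (divides y refl) with go y (rs (m<m*n y (2+ k) sz<ss))
      where instance y≢0 = m*n≢0⇒m≢0 y
    ...   | a , valuation c b∤c refl = suc a , valuation c b∤c (reassoc (2+ k ^ a) c (2+ k))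
      where
      reassoc : ∀ x c b → x * c * b ≡ b * x * c
      reassoc = solve-∀

  module _ {p : ℕ} (isPrime : Prime p) where

    private instance
      p≢0 : NonZero p
      p≢0 = prime⇒nonZero isPrime

    ∤-* : ∀ {x y} → ¬ p ∣ x → ¬ p ∣ y → ¬ p ∣ x * y
    ∤-* p∤x p∤y p∣xy with euclidsLemma _ _ isPrime p∣xy
    ... | inj₁ p∣x = p∤x p∣x
    ... | inj₂ p∣y = p∤y p∣y

    ^∣-cancelʳ : ∀ {x c} v → ¬ p ∣ c → p ^ v ∣ x * c → p ^ v ∣ x
    ^∣-cancelʳ             zero    _   _   = 1∣ _
    ^∣-cancelʳ {x} {c} (suc v) p∤c p^v+1∣xc with ^∣-cancelʳ {x} v p∤c (∣-trans (n∣m*n p) p^v+1∣xc)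
    ... | divides y refl = *-monoˡ-∣ (p ^ v) p∣y
      where
      instance _ = m^n≢0 p v
      p∣yc : p ∣ y * c
      p∣yc = *-cancelˡ-∣ (p ^ v) (subst₂ _∣_ (*-comm p (p ^ v)) (reassoc y (p ^ v) c) p^v+1∣xc)
        where
        reassoc : ∀ y q c → y * q * c ≡ q * (y * c)
        reassoc = solve-∀
      p∣y : p ∣ y
      p∣y with euclidsLemma y c isPrime p∣yc
      ... | inj₁ p∣y = p∣y
      ... | inj₂ p∣c = ⊥-elim (p∤c p∣c)

    ∤⇒coprime : ∀ {c} → ¬ p ∣ c → Coprime c p
    ∤⇒coprime p∤c (i∣c , i∣p) with prime⇒irreducible isPrime i∣p
    ... | inj₁ i≡1  = i≡1
    ... | inj₂ refl = ⊥-elim (p∤c i∣c)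

    ∣^*-cancelˡ : ∀ {c Y} a → ¬ p ∣ c → c ∣ p ^ a * Y → c ∣ Y
    ∣^*-cancelˡ {c} {Y} zero    p∤c c∣1*Y = subst (c ∣_) (*-identityˡ Y) c∣1*Y
    ∣^*-cancelˡ {c} {Y} (suc a) p∤c c∣p*p^a*Y =
      ∣^*-cancelˡ a p∤c (coprime-divisor (∤⇒coprime p∤c) (subst (c ∣_) (*-assoc p (p ^ a) Y) c∣p*p^a*Y))

    ^*-∣ : ∀ {c X} a → ¬ p ∣ c → p ^ a ∣ X → c ∣ X → p ^ a * c ∣ X
    ^*-∣ {c} a p∤c (divides Y refl) c∣Y*p^a = subst (p ^ a * c ∣_) (*-comm (p ^ a) Y)
      (*-monoʳ-∣ (p ^ a) (∣^*-cancelˡ a p∤c (subst (c ∣_) (*-comm Y (p ^ a)) c∣Y*p^a)))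

    valuation-* : ∀ {x y a b} → Valuation p x a → Valuation p y b → Valuation p (x * y) (a + b)
    valuation-* {a = a} {b} (valuation c p∤c refl) (valuation d p∤d refl) =
      valuation (c * d) (∤-* p∤c p∤d) (trans (regroup (p ^ a) c (p ^ b) d) (cong (_* (c * d)) (sym (^-distribˡ-+-* p a b))))
      where
      regroup : ∀ x c y d → x * c * (y * d) ≡ x * y * (c * d)
      regroup = solve-∀

    valuation-cancel : ∀ {x y a b} → Valuation p y a → Valuation p (x * y) b → ∃[ v ] a + v ≡ b × p ^ v ∣ x
    valuation-cancel {x} {a = a} {b} (valuation c p∤c refl) (valuation u p∤u x*p^a*c≡p^b*u) with a ≤? b
    ... | yes a≤b = v , a+v≡b , ^∣-cancelʳ v p∤c (divides u (*-cancelˡ-≡ _ _ (p ^ a) (begin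
        p ^ a * (x * c)        ≡⟨ rearrange (p ^ a) x c ⟩
        x * (p ^ a * c)        ≡⟨ x*p^a*c≡p^b*u ⟩
        p ^ b * u              ≡⟨ cong (λ e → p ^ e * u) a+v≡b ⟨
        p ^ (a + v) * u        ≡⟨ cong (_* u) (^-distribˡ-+-* p a v) ⟩
        p ^ a * p ^ v * u      ≡⟨ rearrange′ (p ^ a) (p ^ v) u ⟩
        p ^ a * (u * p ^ v)    ∎)))
      where
      open ≡-Reasoning
      v = b ∸ a
      a+v≡b = m+[n∸m]≡n a≤b
      instance _ = m^n≢0 p a
      rearrange : ∀ x y z → x * (y * z) ≡ y * (x * z)
      rearrange = solve-∀
      rearrange′ : ∀ x y z → x * y * z ≡ x * (z * y)
      rearrange′ = solve-∀
    ... | no  a≰b = ⊥-elim (p∤u (divides (x * c * p ^ e) (*-cancelˡ-≡ _ _ (p ^ b) (begin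
        p ^ b * u                  ≡⟨ x*p^a*c≡p^b*u ⟨
        x * (p ^ a * c)            ≡⟨ cong (λ e → x * (p ^ e * c)) a≡b+[1+e] ⟩
        x * (p ^ (b + suc e) * c)  ≡⟨ cong (λ q → x * (q * c)) (^-distribˡ-+-* p b (suc e)) ⟩
        x * (p ^ b * (p * p ^ e) * c) ≡⟨ rearrange x (p ^ b) p (p ^ e) c ⟩
        p ^ b * (x * c * p ^ e * p) ∎))))
      where
      open ≡-Reasoning
      e = a ∸ suc b
      instance _ = m^n≢0 p b
      a≡b+[1+e] : a ≡ b + suc e
      a≡b+[1+e] = trans (sym (m+[n∸m]≡n (≰⇒> a≰b))) (sym (+-suc b e))
      rearrange : ∀ x q p r c → x * (q * (p * r) * c) ≡ q * (x * c * r * p)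
      rearrange = solve-∀

  module _ (k : ℕ) where

    digitSum-^* : ∀ a c → digitSum (2+ k) (2+ k ^ a * c) ≡ digitSum (2+ k) c
    digitSum-^* zero    c = cong (digitSum (2+ k)) (*-identityˡ c)
    digitSum-^* (suc a) c = begin
      digitSum (2+ k) (2+ k * 2+ k ^ a * c)      ≡⟨ cong (digitSum (2+ k)) (rearrange (2+ k) (2+ k ^ a) c) ⟩
      digitSum (2+ k) (0 + 2+ k ^ a * c * 2+ k)  ≡⟨ digitSum-+* k (2+ k ^ a * c) z<s ⟩
      digitSum (2+ k) (2+ k ^ a * c)            ≡⟨ digitSum-^* a c ⟩
      digitSum (2+ k) c                         ∎
      where
      open ≡-Reasoning
      rearrange : ∀ b q c → b * q * c ≡ 0 + q * c * b
      rearrange = solve-∀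

    digitSum-positive : ∀ n .{{_ : NonZero n}} → 1 ≤ digitSum (2+ k) n
    digitSum-positive n with valuation-exists k n
    ... | a , valuation c b∤c refl = begin
      1                                     ≤⟨ n≢0⇒n>0 c%b≢0 ⟩
      c % 2+ k                              ≤⟨ m≤m+n (c % 2+ k) _ ⟩
      c % 2+ k + digitSum (2+ k) (c / 2+ k)  ≡⟨ digitSum-divMod k c ⟨
      digitSum (2+ k) c                     ≡⟨ digitSum-^* a c ⟨
      digitSum (2+ k) (2+ k ^ a * c)         ∎
      where
      open ≤-Reasoning
      c%b≢0 : c % 2+ k ≢ 0
      c%b≢0 = b∤c ∘ m%n≡0⇒n∣m c (2+ k)

    digitSum-suc : ∀ {m a} → Valuation (2+ k) (suc m) a →
                   digitSum (2+ k) m + 1 ≡ digitSum (2+ k) (suc m) + suc k * a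
    digitSum-suc {m} {zero} (valuation c b∤c 1+m≡1*c) = begin
      digitSum (2+ k) m + 1                 ≡⟨ cong (λ x → digitSum (2+ k) x + 1) m≡r+q*b ⟩
      digitSum (2+ k) (r + q * 2+ k) + 1     ≡⟨ cong (_+ 1) (digitSum-+* k q (m%n<n m (2+ k))) ⟩
      r + digitSum (2+ k) q + 1             ≡⟨ +-comm (r + digitSum (2+ k) q) 1 ⟩
      suc r + digitSum (2+ k) q             ≡⟨ digitSum-+* k q 1+r<b ⟨
      digitSum (2+ k) (suc r + q * 2+ k)     ≡⟨ cong (digitSum (2+ k) ∘ suc) m≡r+q*b ⟨
      digitSum (2+ k) (suc m)               ≡⟨ +-identityʳ _ ⟨
      digitSum (2+ k) (suc m) + 0           ≡⟨ cong (digitSum (2+ k) (suc m) +_) (*-zeroʳ (suc k)) ⟨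
      digitSum (2+ k) (suc m) + suc k * 0   ∎
      where
      open ≡-Reasoning
      r = m % 2+ k
      q = m / 2+ k
      m≡r+q*b = m≡m%n+[m/n]*n m (2+ k)
      1+r<b : suc r < 2+ k
      1+r<b with m<1+n⇒m<n∨m≡n (m%n<n m (2+ k))
      ... | inj₁ r<1+k = s<s r<1+k
      ... | inj₂ r≡1+k = ⊥-elim (b∤c (subst (2+ k ∣_) (trans 1+m≡1*c (*-identityˡ c))
                           (divides (suc q) (cong suc (trans m≡r+q*b (cong (_+ q * 2+ k) r≡1+k))))))
    digitSum-suc {m} {suc a} (valuation c b∤c 1+m≡b^[1+a]*c) with 2+ k ^ a * c in q≡b^a*c
    ... | zero  = ⊥-elim (1+n≢0 (trans 1+m≡b^[1+a]*c
                    (trans (*-assoc (2+ k) (2+ k ^ a) c) (trans (cong (2+ k *_) q≡b^a*c) (*-zeroʳ (2+ k))))))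
    ... | suc q = begin
      digitSum (2+ k) m + 1                         ≡⟨ cong (λ x → digitSum (2+ k) x + 1) m≡1+k+q*b ⟩
      digitSum (2+ k) (suc k + q * 2+ k) + 1         ≡⟨ cong (_+ 1) (digitSum-+* k q ≤-refl) ⟩
      suc k + digitSum (2+ k) q + 1                 ≡⟨ +-assoc (suc k) (digitSum (2+ k) q) 1 ⟩
      suc k + (digitSum (2+ k) q + 1)               ≡⟨ cong (suc k +_) (digitSum-suc (valuation c b∤c (sym q≡b^a*c))) ⟩
      suc k + (digitSum (2+ k) (suc q) + suc k * a) ≡⟨ rearrange (suc k) (digitSum (2+ k) (suc q)) a ⟩
      digitSum (2+ k) (suc q) + suc k * suc a       ≡⟨ cong (_+ suc k * suc a) (digitSum-+* k (suc q) z<s) ⟨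
      digitSum (2+ k) (suc q * 2+ k) + suc k * suc a ≡⟨ cong (λ x → digitSum (2+ k) x + suc k * suc a) 1+m≡[1+q]*b ⟨
      digitSum (2+ k) (suc m) + suc k * suc a       ∎
      where
      open ≡-Reasoning
      1+m≡[1+q]*b : suc m ≡ suc q * 2+ k
      1+m≡[1+q]*b = begin
        suc m                   ≡⟨ 1+m≡b^[1+a]*c ⟩
        2+ k * 2+ k ^ a * c     ≡⟨ *-assoc (2+ k) (2+ k ^ a) c ⟩
        2+ k * (2+ k ^ a * c)   ≡⟨ cong (2+ k *_) q≡b^a*c ⟩
        2+ k * suc q            ≡⟨ *-comm (2+ k) (suc q) ⟩
        suc q * 2+ k            ∎
      m≡1+k+q*b : m ≡ suc k + q * 2+ k
      m≡1+k+q*b = suc-injective 1+m≡[1+q]*b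
      rearrange : ∀ k s a → k + (s + k * a) ≡ s + k * suc a
      rearrange = solve-∀

  -- Legendre's and Kummer's formulas

  module _ {k : ℕ} (isPrime : Prime (2+ k)) where

    private
      s : ℕ → ℕ
      s = digitSum (2+ k)

    legendre : ∀ m → ∃[ L ] Valuation (2+ k) (m !) L × suc k * L + s m ≡ m
    legendre zero    = 0 , valuation 1 b∤1 refl , cong (_+ 0) (*-zeroʳ (suc k))
      where
      b∤1 : ¬ 2+ k ∣ 1
      b∤1 b∣1 with () ← ∣1⇒≡1 b∣1
    legendre (suc m) with legendre m | valuation-exists k (suc m)
    ... | L , vL , qL+sm≡m | a , va = a + L , valuation-* isPrime va vL , (begin
      suc k * (a + L) + s (suc m)         ≡⟨ rearrange (suc k) a L (s (suc m)) ⟩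
      suc k * L + (s (suc m) + suc k * a) ≡⟨ cong (suc k * L +_) (digitSum-suc k va) ⟨
      suc k * L + (s m + 1)               ≡⟨ +-assoc (suc k * L) (s m) 1 ⟨
      suc k * L + s m + 1                 ≡⟨ cong (_+ 1) qL+sm≡m ⟩
      m + 1                               ≡⟨ +-comm m 1 ⟩
      suc m                               ∎)
      where
      open ≡-Reasoning
      rearrange : ∀ q a L x → q * (a + L) + x ≡ q * L + (x + q * a)
      rearrange = solve-∀

    kummer : ∀ l r C → (l + r) ! ≡ C * (l ! * r !) →
             ∃[ v ] 2+ k ^ v ∣ C × s l + s r ≡ suc k * v + s (l + r)
    kummer l r C [l+r]!≡C*l!*r! with legendre l | legendre r | legendre (l + r)
    ... | L₁ , val₁ , e₁ | L₂ , val₂ , e₂ | L , val , e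
      with valuation-cancel isPrime (valuation-* isPrime val₁ val₂) (subst (λ x → Valuation (2+ k) x L) [l+r]!≡C*l!*r! val)
    ... | w , L₁+L₂+w≡L , b^w∣C = w , b^w∣C , +-cancelˡ-≡ (suc k * (L₁ + L₂)) _ _ (begin
      suc k * (L₁ + L₂) + (s l + s r)                 ≡⟨ interchange (suc k) L₁ L₂ (s l) (s r) ⟩
      (suc k * L₁ + s l) + (suc k * L₂ + s r)          ≡⟨ cong₂ _+_ e₁ e₂ ⟩
      l + r                                           ≡⟨ e ⟨
      suc k * L + s (l + r)                           ≡⟨ cong (λ x → suc k * x + s (l + r)) L₁+L₂+w≡L ⟨
      suc k * (L₁ + L₂ + w) + s (l + r)               ≡⟨ regroup (suc k) (L₁ + L₂) w (s (l + r)) ⟩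
      suc k * (L₁ + L₂) + (suc k * w + s (l + r))     ∎)
      where
      open ≡-Reasoning
      interchange : ∀ q x y a b → q * (x + y) + (a + b) ≡ (q * x + a) + (q * y + b)
      interchange = solve-∀
      regroup : ∀ q x w z → q * (x + w) + z ≡ q * x + (q * w + z)
      regroup = solve-∀

  -- v_p(N) ≥ ⌈(j − s_p(m)) / (p − 1)⌉ for every prime p: by Kummer's formula this
  -- holds for each multinomial coefficient m! / (l₁! ⋯ l_j!) with all lᵢ ≥ 1.
  record KummerBound (j m N : ℕ) : Set where
    field
      power∣ : ∀ {k} → Prime (2+ k) → ∀ e → suc k * e + digitSum (2+ k) m < j + suc k → 2+ k ^ e ∣ N

  open KummerBound public

  kummerBound-0 : ∀ {j m} → KummerBound j m 0
  kummerBound-0 .power∣ _ _ _ = _ ∣0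

  kummerBound-+ : ∀ {j m M N} → KummerBound j m M → KummerBound j m N → KummerBound j m (M + N)
  kummerBound-+ bound bound′ .power∣ isPrime e lt = ∣m∣n⇒∣m+n (power∣ bound isPrime e lt) (power∣ bound′ isPrime e lt)

  kummerBound-*ˡ : ∀ {j m N} M → KummerBound j m N → KummerBound j m (M * N)
  kummerBound-*ˡ M bound .power∣ isPrime e lt = ∣n⇒∣m*n M (power∣ bound isPrime e lt)

  kummerBound-1 : KummerBound 0 0 1
  kummerBound-1 .power∣     _ zero    _  = ∣-refl
  kummerBound-1 .power∣ {k} _ (suc e) lt = ⊥-elim (<⇒≱ lt (≤-trans (m≤m*n (suc k) (suc e)) (m≤m+n _ _)))

  kummerBound-step : ∀ {j l r C N} .{{_ : NonZero l}} → (l + r) ! ≡ C * (l ! * r !) →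
                     KummerBound j r N → KummerBound (suc j) (l + r) (C * N)
  kummerBound-step {j} {l} {r} {C} {N} [l+r]!≡C*l!*r! bound .power∣ {k} isPrime e lt
    with kummer isPrime l r C [l+r]!≡C*l!*r!
  ... | v , b^v∣C , sl+sr≡qv+s[l+r] with e ≤? v
  ...   | yes e≤v = ∣m⇒∣m*n N (∣-trans (^-monoʳ-∣ (2+ k) e≤v) b^v∣C)
  ...   | no  e≰v = subst (λ x → 2+ k ^ x ∣ C * N) v+e′≡e
                      (subst (_∣ C * N) (sym (^-distribˡ-+-* (2+ k) v e′))
                        (*-pres-∣ b^v∣C (power∣ bound isPrime e′ (s<s⁻¹ lt′))))
    where
    open ≤-Reasoning
    s = digitSum (2+ k)
    q = suc k
    e′ = e ∸ v
    v+e′≡e : v + e′ ≡ e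
    v+e′≡e = m+[n∸m]≡n (<⇒≤ (≰⇒> e≰v))
    lt′ : suc (q * e′ + s r) < suc (j + q)
    lt′ = begin-strict
      suc (q * e′ + s r)          ≡⟨ +-comm 1 _ ⟩
      q * e′ + s r + 1            ≤⟨ +-monoʳ-≤ (q * e′ + s r) (digitSum-positive k l) ⟩
      q * e′ + s r + s l          ≡⟨ swap (q * e′) (s r) (s l) ⟩
      q * e′ + (s l + s r)        ≡⟨ cong (q * e′ +_) sl+sr≡qv+s[l+r] ⟩
      q * e′ + (q * v + s (l + r)) ≡⟨ regroup q e′ v (s (l + r)) ⟩
      q * (v + e′) + s (l + r)    ≡⟨ cong (λ x → q * x + s (l + r)) v+e′≡e ⟩
      q * e + s (l + r)           <⟨ lt ⟩
      suc j + q                   ∎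
      where
      swap : ∀ x a b → x + a + b ≡ x + (b + a)
      swap = solve-∀
      regroup : ∀ q e′ v z → q * e′ + (q * v + z) ≡ q * (v + e′) + z
      regroup = solve-∀

  -- The exponents in d n

  n<b^n : ∀ k n → n < 2+ k ^ n
  n<b^n k zero    = z<s
  n<b^n k (suc n) = begin-strict
    suc n                          <⟨ s<s (n<b^n k n) ⟩
    suc (2+ k ^ n)                 ≤⟨ +-monoˡ-≤ (2+ k ^ n) (m^n>0 (2+ k) n) ⟩
    2+ k ^ n + 2+ k ^ n            ≤⟨ +-monoʳ-≤ (2+ k ^ n) (m≤m+n (2+ k ^ n) (k * 2+ k ^ n)) ⟩
    2+ k ^ n + (2+ k ^ n + k * 2+ k ^ n) ≡⟨⟩
    2+ k ^ suc n                   ∎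
    where open ≤-Reasoning

  ∈⇒≤foldr-⊔ : ∀ {x xs} → x ∈ xs → x ≤ foldr _⊔_ 0 xs
  ∈⇒≤foldr-⊔ {xs = y ∷ ys} (here refl) = m≤m⊔n y (foldr _⊔_ 0 ys)
  ∈⇒≤foldr-⊔ {xs = y ∷ ys} (there x∈ys) = ≤-trans (∈⇒≤foldr-⊔ x∈ys) (m≤n⊔m y (foldr _⊔_ 0 ys))

  maxExp-maximal : ∀ k {S} j → 2+ k ^ j ≤ S → j ≤ maxExp (2+ k) S
  maxExp-maximal k {S} j b^j≤S =
    ∈⇒≤foldr-⊔ (∈-filter⁺ (λ t → 2+ k ^ t ≤? S) (∈-upTo⁺ (s<s (≤-trans (<⇒≤ (n<b^n k j)) b^j≤S))) b^j≤S)

  <^suc-maxExp : ∀ k S → S < 2+ k ^ suc (maxExp (2+ k) S)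
  <^suc-maxExp k S = ≰⇒> (λ b^[1+M]≤S → 1+n≰n (maxExp-maximal k _ b^[1+M]≤S))

  digitSum-< : ∀ {k n} → n < 2+ k → digitSum (2+ k) n ≡ n
  digitSum-< {k} {n} n<b = begin
    digitSum (2+ k) n              ≡⟨ cong (digitSum (2+ k)) (+-identityʳ n) ⟨
    digitSum (2+ k) (n + 0 * 2+ k)  ≡⟨ digitSum-+* k 0 n<b ⟩
    n + 0                          ≡⟨ +-identityʳ n ⟩
    n                              ∎
    where open ≡-Reasoning

  digitSum-base : ∀ k → digitSum (2+ k) (2+ k) ≡ 1
  digitSum-base k = begin
    digitSum (2+ k) (2+ k)           ≡⟨ cong (digitSum (2+ k)) (+-identityʳ (2+ k)) ⟨
    digitSum (2+ k) (0 + 1 * 2+ k)    ≡⟨ digitSum-+* k 1 z<s ⟩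
    digitSum (2+ k) 1                ≡⟨ digitSum-< {k} (s<s z<s) ⟩
    1                                ∎
    where open ≡-Reasoning

  d-exponent : ∀ {k} → Prime (2+ k) → ∀ n → ∃[ t ] 2+ k ^ t ∣ d n × digitSum (2+ k) n < 2+ k ^ suc t
  d-exponent {k} isPrime n with 2+ k <? n
  ... | yes p<n = maxExp (2+ k) (digitSum (2+ k) n) ,
                  ∈⇒∣product (∈-map⁺ _ (∈-filter⁺ prime? (∈-upTo⁺ p<n) isPrime)) ,
                  <^suc-maxExp k (digitSum (2+ k) n)
  ... | no  p≮n = 0 , 1∣ _ , subst (digitSum (2+ k) n <_) (sym (*-identityʳ (2+ k))) s[n]<p
    where
    s[n]<p : digitSum (2+ k) n < 2+ k
    s[n]<p with m≤n⇒m<n∨m≡n (≮⇒≥ p≮n)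
    ... | inj₁ n<p  = subst (_< 2+ k) (sym (digitSum-< n<p)) n<p
    ... | inj₂ refl = subst (_< 2+ k) (sym (digitSum-base k)) (s<s z<s)

  bernoulli : ∀ k {P} m → 1 ≤ P → P + suc k * m ≤ P * 2+ k ^ m
  bernoulli k {P} zero    1≤P = ≤-reflexive (trans (cong (P +_) (*-zeroʳ (suc k))) (trans (+-identityʳ P) (sym (*-identityʳ P))))
  bernoulli k {P} (suc m) 1≤P = begin
    P + suc k * suc m                          ≡⟨ split P (suc k) m ⟩
    (P + suc k * m) + suc k * 1                ≤⟨ +-mono-≤ (bernoulli k m 1≤P) (*-monoʳ-≤ (suc k) 1≤P*b^m) ⟩
    P * 2+ k ^ m + suc k * (P * 2+ k ^ m)      ≡⟨ merge P (2+ k ^ m) k ⟩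
    P * 2+ k ^ suc m                           ∎
    where
    open ≤-Reasoning
    1≤P*b^m : 1 ≤ P * 2+ k ^ m
    1≤P*b^m = ≤-trans 1≤P (m≤m*n P (2+ k ^ m) {{m^n≢0 (2+ k) m}})
    split : ∀ P q m → P + q * suc m ≡ (P + q * m) + q * 1
    split = solve-∀
    merge : ∀ P x k → P * x + suc k * (P * x) ≡ P * (2+ k * x)
    merge = solve-∀

  exponent-gap : ∀ k {S K} t m → S < 2+ k ^ suc t → 2+ k ^ (t + suc m) ≤ K → suc k * suc m + S < K + suc k
  exponent-gap k {S} {K} t m S<P b^[t+1+m]≤K = begin-strict
    suc k * suc m + S        <⟨ +-monoʳ-< (suc k * suc m) S<P ⟩
    suc k * suc m + P        ≡⟨ rearrange (suc k) m P ⟩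
    suc k + (P + suc k * m)  ≤⟨ +-monoʳ-≤ (suc k) (bernoulli k m (m^n>0 (2+ k) (suc t))) ⟩
    suc k + P * 2+ k ^ m     ≡⟨ cong (suc k +_) (^-distribˡ-+-* (2+ k) (suc t) m) ⟨
    suc k + 2+ k ^ (suc t + m) ≡⟨ cong (λ e → suc k + 2+ k ^ e) (+-suc t m) ⟨
    suc k + 2+ k ^ (t + suc m) ≤⟨ +-monoʳ-≤ (suc k) b^[t+1+m]≤K ⟩
    suc k + K                ≡⟨ +-comm (suc k) K ⟩
    K + suc k                ∎
    where
    open ≤-Reasoning
    P = 2+ k ^ suc t
    rearrange : ∀ q m P → q * suc m + P ≡ q + (P + q * m)
    rearrange = solve-∀

  prime-∣ : ∀ x .{{_ : NonTrivial x}} → ∃[ k ] Prime (2+ k) × 2+ k ∣ x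
  prime-∣ x with factorise x {{nonTrivial⇒nonZero x}}
  ... | record { factors = [] ; isFactorisation = x≡1 } = ⊥-elim (nonTrivial⇒≢1 x≡1)
  ... | record { factors = 2+ k ∷ ps ; isFactorisation = x≡∏ ; factorsPrime = isPrime All.∷ _ } =
    k , isPrime , subst (2+ k ∣_) (sym x≡∏) (∈⇒∣product {ns = 2+ k ∷ ps} (here refl))

  ∣-byPrimePowers : ∀ x {X} .{{_ : NonZero x}} → (∀ {k} → Prime (2+ k) → ∀ e → 2+ k ^ e ∣ x → 2+ k ^ e ∣ X) → x ∣ X
  ∣-byPrimePowers x {X} = go x (<-wellFounded-fast x)
    where
    go : ∀ x → Acc _<_ x → .{{NonZero x}} → (∀ {k} → Prime (2+ k) → ∀ e → 2+ k ^ e ∣ x → 2+ k ^ e ∣ X) → x ∣ X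
    go 1          _        _       = 1∣ X
    go x@(2+ _) (acc rs) powers∣X with prime-∣ x
    ... | k , isPrime , b∣x with valuation-exists k x
    ... | a , valuation c b∤c x≡b^a*c =
      subst (_∣ X) (sym x≡b^a*c) (^*-∣ isPrime a b∤c (powers∣X isPrime a b^a∣x) c∣X)
      where
      b^a∣x : 2+ k ^ a ∣ x
      b^a∣x = divides c (trans x≡b^a*c (*-comm (2+ k ^ a) c))
      c∣x : c ∣ x
      c∣x = divides (2+ k ^ a) x≡b^a*c
      c≢0 : NonZero c
      c≢0 = ≢-nonZero λ { refl → b∤c (2+ k ∣0) }
      c<x : ∀ a → x ≡ 2+ k ^ a * c → c < x
      c<x zero    x≡1*c = ⊥-elim (b∤c (subst (2+ k ∣_) (trans x≡1*c (*-identityˡ c)) b∣x))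
      c<x (suc a) x≡b^[1+a]*c = begin-strict
        c               ≡⟨ *-identityˡ c ⟨
        1 * c           <⟨ *-monoˡ-< c {{c≢0}} (<-≤-trans (s<s z<s) (*-monoʳ-≤ (2+ k) (m^n>0 (2+ k) a))) ⟩
        2+ k ^ suc a * c ≡⟨ x≡b^[1+a]*c ⟨
        x               ∎
        where open ≤-Reasoning
      c∣X : c ∣ X
      c∣X = go c (rs (c<x a x≡b^a*c)) {{c≢0}} (λ isPrime′ e q∣c → powers∣X isPrime′ e (∣-trans q∣c c∣x))

  kummerBound⇒∣d* : ∀ {j n N} .{{_ : NonZero j}} → KummerBound j n N → j ∣ d n * N
  kummerBound⇒∣d* {j} {n} {N} bound = ∣-byPrimePowers j prime-power-∣
    where
    prime-power-∣ : ∀ {k} → Prime (2+ k) → ∀ e → 2+ k ^ e ∣ j → 2+ k ^ e ∣ d n * N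
    prime-power-∣ {k} isPrime e b^e∣j with d-exponent isPrime n
    ... | t , b^t∣dn , s[n]<b^[1+t] with e ≤? t
    ...   | yes e≤t = ∣m⇒∣m*n N (∣-trans (^-monoʳ-∣ (2+ k) e≤t) b^t∣dn)
    ...   | no  e≰t = subst (λ x → 2+ k ^ x ∣ d n * N) t+[1+m]≡e
                        (subst (_∣ d n * N) (sym (^-distribˡ-+-* (2+ k) t (suc m)))
                          (*-pres-∣ b^t∣dn (power∣ bound isPrime (suc m) (exponent-gap k t m s[n]<b^[1+t] b^[t+1+m]≤j))))
      where
      m = e ∸ suc t
      t+[1+m]≡e : t + suc m ≡ e
      t+[1+m]≡e = trans (+-suc t m) (m+[n∸m]≡n (≰⇒> e≰t))
      b^[t+1+m]≤j : 2+ k ^ (t + suc m) ≤ j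
      b^[t+1+m]≤j = subst (λ x → 2+ k ^ x ≤ j) (sym t+[1+m]≡e) (∣⇒≤ b^e∣j)

module Coefficients where

  open import Data.Integer.Base as ℤ using (ℤ; +_)
  import Data.Integer.Properties as ℤ
  import Data.Integer.Tactic.RingSolver as ℤ-Solver
  open import Data.List.Base using ([]; _∷_; length; map; upTo)
  open import Data.List.Membership.Propositional using (_∈_)
  open import Data.List.Membership.Propositional.Properties using (∈-map⁻; ∈-upTo⁻)
  open import Data.List.Relation.Unary.Any using (here; there)
  open import Data.Nat.Base as ℕ using (ℕ; zero; suc; NonZero; _!)
  import Data.Nat.Properties as ℕ
  open import Data.Nat.Combinatorics using (k![n∸k]!∣n!)
  open import Data.Nat.Coprimality using (coprime-divisor) renaming (sym to coprime-sym; recompute to recompute-coprime)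
  open import Data.Nat.Divisibility using (_∣_; divides; m≤n⇒m!∣n!)
  open import Data.Product.Base using (∃-syntax; _×_; _,_)
  open import Data.Rational.Base as ℚ using (ℚ; mkℚ; 0ℚ; _+_; _*_; -_; toℚᵘ)
  open import Data.Rational.Properties
    using (toℚᵘ-injective; toℚᵘ-fromℚᵘ; toℚᵘ-homo-+; toℚᵘ-homo-*; toℚᵘ-homo‿-; toℚᵘ-cong;
           *-assoc; *-zeroˡ; *-zeroʳ; *-distribˡ-+; +-identityʳ)
  open import Data.Rational.Unnormalised.Base as ℚᵘ using (mkℚᵘ; *≡*; _≃_)
  import Data.Rational.Unnormalised.Properties as ℚᵘ
  open import Relation.Binary.PropositionalEquality
  open import Data.Rational.Solver using (module +-*-Solver)
  open import Function.Base using (_∘_)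

  open import Defs
  open NumberTheory
    using (KummerBound; kummerBound-0; kummerBound-+; kummerBound-*ˡ; kummerBound-1; kummerBound-step; kummerBound⇒∣d*)

  fromℤ : ℤ → ℚ
  fromℤ z = z ℚ./ 1

  fromℕ : ℕ → ℚ
  fromℕ n = fromℤ (+ n)

  toℚᵘ-fromℤ : ∀ z → toℚᵘ (fromℤ z) ≃ mkℚᵘ z 0
  toℚᵘ-fromℤ z = toℚᵘ-fromℚᵘ (mkℚᵘ z 0)

  ≃-fromℤ : ∀ q z → toℚᵘ q ≃ mkℚᵘ z 0 → q ≡ fromℤ z
  ≃-fromℤ q z q≃z = toℚᵘ-injective (ℚᵘ.≃-trans q≃z (ℚᵘ.≃-sym (toℚᵘ-fromℤ z)))

  fromℤ-homo-+ : ∀ a b → fromℤ (a ℤ.+ b) ≡ fromℤ a + fromℤ b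
  fromℤ-homo-+ a b = sym (≃-fromℤ _ _ (begin
    toℚᵘ (fromℤ a + fromℤ b)            ≈⟨ toℚᵘ-homo-+ (fromℤ a) (fromℤ b) ⟩
    toℚᵘ (fromℤ a) ℚᵘ.+ toℚᵘ (fromℤ b)   ≈⟨ ℚᵘ.+-cong (toℚᵘ-fromℤ a) (toℚᵘ-fromℤ b) ⟩
    mkℚᵘ a 0 ℚᵘ.+ mkℚᵘ b 0              ≈⟨ *≡* (add-over-1 a b) ⟩
    mkℚᵘ (a ℤ.+ b) 0                    ∎))
    where
    open ℚᵘ.≃-Reasoning
    add-over-1 : ∀ a b → (a ℤ.* + 1 ℤ.+ b ℤ.* + 1) ℤ.* + 1 ≡ (a ℤ.+ b) ℤ.* + 1
    add-over-1 = ℤ-Solver.solve-∀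

  fromℤ-homo-* : ∀ a b → fromℤ (a ℤ.* b) ≡ fromℤ a * fromℤ b
  fromℤ-homo-* a b = sym (≃-fromℤ _ _
    (ℚᵘ.≃-trans (toℚᵘ-homo-* (fromℤ a) (fromℤ b)) (ℚᵘ.*-cong (toℚᵘ-fromℤ a) (toℚᵘ-fromℤ b))))

  fromℤ-homo‿- : ∀ a → fromℤ (ℤ.- a) ≡ - fromℤ a
  fromℤ-homo‿- a = sym (≃-fromℤ _ _ (ℚᵘ.≃-trans (toℚᵘ-homo‿- (fromℤ a)) (ℚᵘ.-‿cong (toℚᵘ-fromℤ a))))

  fromℕ-homo-+ : ∀ m n → fromℕ (m ℕ.+ n) ≡ fromℕ m + fromℕ n
  fromℕ-homo-+ m n = trans (cong fromℤ (ℤ.pos-+ m n)) (fromℤ-homo-+ (+ m) (+ n))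

  fromℕ-homo-* : ∀ m n → fromℕ (m ℕ.* n) ≡ fromℕ m * fromℕ n
  fromℕ-homo-* m n = trans (cong fromℤ (ℤ.pos-* m n)) (fromℤ-homo-* (+ m) (+ n))

  fromℕ-*-/ : ∀ m n .{{_ : NonZero n}} → fromℕ (m ℕ.* n) * (+ 1 ℚ./ n) ≡ fromℕ m
  fromℕ-*-/ m (suc n) = ≃-fromℤ _ _ (begin
    toℚᵘ (fromℕ (m ℕ.* suc n) * (+ 1 ℚ./ suc n))         ≈⟨ toℚᵘ-homo-* (fromℕ (m ℕ.* suc n)) (+ 1 ℚ./ suc n) ⟩
    toℚᵘ (fromℕ (m ℕ.* suc n)) ℚᵘ.* toℚᵘ (+ 1 ℚ./ suc n)  ≈⟨ ℚᵘ.*-cong (toℚᵘ-fromℤ (+ (m ℕ.* suc n))) (toℚᵘ-fromℚᵘ (mkℚᵘ (+ 1) n)) ⟩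
    mkℚᵘ (+ (m ℕ.* suc n)) 0 ℚᵘ.* mkℚᵘ (+ 1) n           ≈⟨ *≡* (trans (cong (λ z → (z ℤ.* + 1) ℤ.* + 1) (ℤ.pos-* m (suc n)))
                                                                  (trans (cancel (+ m) (+ suc n)) (cong (+ m ℤ.*_) (ℤ.pos-* 1 (suc n))))) ⟩
    mkℚᵘ (+ m) 0                                        ∎)
    where
    open ℚᵘ.≃-Reasoning
    cancel : ∀ a d → (a ℤ.* d ℤ.* + 1) ℤ.* + 1 ≡ a ℤ.* (+ 1 ℤ.* d)
    cancel = ℤ-Solver.solve-∀

  IsInteger : ℚ → Set
  IsInteger q = ∃[ z ] q ≡ fromℤ z

  IsNatural : ℚ → Set
  IsNatural q = ∃[ n ] q ≡ fromℕ n

  KummerNatural : ℕ → ℕ → ℚ → Set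
  KummerNatural j m q = ∃[ N ] q ≡ fromℕ N × KummerBound j m N

  integer-0 : IsInteger 0ℚ
  integer-0 = + 0 , refl

  integer-+ : ∀ {a b} → IsInteger a → IsInteger b → IsInteger (a + b)
  integer-+ (y , refl) (z , refl) = y ℤ.+ z , sym (fromℤ-homo-+ y z)

  integer-* : ∀ {a b} → IsInteger a → IsInteger b → IsInteger (a * b)
  integer-* (y , refl) (z , refl) = y ℤ.* z , sym (fromℤ-homo-* y z)

  natural-0 : IsNatural 0ℚ
  natural-0 = 0 , refl

  natural-+ : ∀ {a b} → IsNatural a → IsNatural b → IsNatural (a + b)
  natural-+ (m , refl) (n , refl) = m ℕ.+ n , sym (fromℕ-homo-+ m n)

  natural-* : ∀ {a b} → IsNatural a → IsNatural b → IsNatural (a * b)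
  natural-* (m , refl) (n , refl) = m ℕ.* n , sym (fromℕ-homo-* m n)

  kummerNatural-0 : ∀ {j m} → KummerNatural j m 0ℚ
  kummerNatural-0 = 0 , refl , kummerBound-0

  kummerNatural-+ : ∀ {j m a b} → KummerNatural j m a → KummerNatural j m b → KummerNatural j m (a + b)
  kummerNatural-+ (M , refl , bound) (N , refl , bound′) = M ℕ.+ N , sym (fromℕ-homo-+ M N) , kummerBound-+ bound bound′

  Σℚ-closed : (Q : ℚ → Set) → Q 0ℚ → (∀ {a b} → Q a → Q b → Q (a + b)) →
              ∀ {X : Set} {f : X → ℚ} xs → (∀ {x} → x ∈ xs → Q (f x)) → Q (Σℚ (map f xs))
  Σℚ-closed Q q₀ q₊ []       _   = q₀
  Σℚ-closed Q q₀ q₊ (x ∷ xs) Qxs = q₊ (Qxs (here refl)) (Σℚ-closed Q q₀ q₊ xs (Qxs ∘ there))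

  *-distribˡ-Σℚ : ∀ c {X : Set} (f : X → ℚ) xs → c * Σℚ (map f xs) ≡ Σℚ (map (λ x → c * f x) xs)
  *-distribˡ-Σℚ c f []       = *-zeroʳ c
  *-distribˡ-Σℚ c f (x ∷ xs) = trans (*-distribˡ-+ c (f x) (Σℚ (map f xs))) (cong (_+_ (c * f x)) (*-distribˡ-Σℚ c f xs))

  *Σℚ-closed : (Q : ℚ → Set) → Q 0ℚ → (∀ {a b} → Q a → Q b → Q (a + b)) →
               ∀ c {X : Set} {f : X → ℚ} xs → (∀ {x} → x ∈ xs → Q (c * f x)) → Q (c * Σℚ (map f xs))
  *Σℚ-closed Q q₀ q₊ c {f = f} xs Qxs = subst Q (sym (*-distribˡ-Σℚ c f xs)) (Σℚ-closed Q q₀ q₊ xs Qxs)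

  splits-length : ∀ w {u v} → (u , v) ∈ splits w → length u ℕ.+ length v ≡ length w
  splits-length []      (here refl) = refl
  splits-length (a ∷ w) (here refl) = refl
  splits-length (a ∷ w) (there uv∈) with ∈-map⁻ _ uv∈
  ... | (u , v) , uv∈splits-w , refl = cong suc (splits-length w uv∈splits-w)

  NaturalSeries : Series → Set
  NaturalSeries X = ∀ w → IsNatural (X w)

  oneS-natural : NaturalSeries oneS
  oneS-natural []      = 1 , refl
  oneS-natural (_ ∷ _) = natural-0

  letterS-natural : ∀ a → NaturalSeries (letterS a)
  letterS-natural a []            = natural-0
  letterS-natural A (A ∷ [])      = 1 , refl
  letterS-natural A (B ∷ [])      = natural-0
  letterS-natural B (A ∷ [])      = natural-0
  letterS-natural B (B ∷ [])      = 1 , refl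
  letterS-natural a (_ ∷ _ ∷ _)   = natural-0

  ⊛-natural : ∀ {X Y} → NaturalSeries X → NaturalSeries Y → NaturalSeries (X ⊛ Y)
  ⊛-natural X-nat Y-nat w = Σℚ-closed IsNatural natural-0 natural-+ (splits w) λ { {u , v} _ → natural-* (X-nat u) (Y-nat v) }

  powS-natural : ∀ {X} → NaturalSeries X → ∀ m → NaturalSeries (powS X m)
  powS-natural X-nat zero    = oneS-natural
  powS-natural X-nat (suc m) = ⊛-natural X-nat (powS-natural X-nat m)

  DividedPowerSeries : Series → Set
  DividedPowerSeries X = ∀ w → IsNatural (fromℕ (length w !) * X w)

  expS-dividedPower : ∀ {X} → NaturalSeries X → DividedPowerSeries (expS X)
  expS-dividedPower {X} X-nat w =
    *Σℚ-closed IsNatural natural-0 natural-+ (fromℕ (length w !)) (upTo (suc (length w))) term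
    where
    1/_! : ℕ → ℚ
    1/ m ! = (+ 1 ℚ./ m !) {{m ℕ.!≢0}}
    term : ∀ {m} → m ∈ upTo (suc (length w)) → IsNatural (fromℕ (length w !) * (1/ m ! * powS X m w))
    term {m} m∈ with m≤n⇒m!∣n! (ℕ.≤-pred (∈-upTo⁻ m∈))
    ... | divides c |w|!≡c*m! = subst IsNatural (sym cancel) (natural-* (c , refl) (powS-natural X-nat m w))
      where
      cancel : fromℕ (length w !) * (1/ m ! * powS X m w) ≡ fromℕ c * powS X m w
      cancel = begin
        fromℕ (length w !) * (1/ m ! * powS X m w)  ≡⟨ *-assoc (fromℕ (length w !)) (1/ m !) (powS X m w) ⟨
        fromℕ (length w !) * 1/ m ! * powS X m w    ≡⟨ cong (λ n → fromℕ n * 1/ m ! * powS X m w) |w|!≡c*m! ⟩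
        fromℕ (c ℕ.* m !) * 1/ m ! * powS X m w     ≡⟨ cong (_* powS X m w) (fromℕ-*-/ c (m !) {{m ℕ.!≢0}}) ⟩
        fromℕ c * powS X m w                       ∎
        where open ≡-Reasoning

  binomial-factorisation : ∀ l r → ∃[ C ] (l ℕ.+ r) ! ≡ C ℕ.* (l ! ℕ.* r !)
  binomial-factorisation l r with k![n∸k]!∣n! {l ℕ.+ r} {l} (ℕ.m≤m+n l r)
  ... | divides C [l+r]!≡C*l!*[l+r∸l]! =
    C , trans [l+r]!≡C*l!*[l+r∸l]! (cong (λ n → C ℕ.* (l ! ℕ.* n !)) (ℕ.m+n∸m≡n l r))

  factorial-* : ∀ l r C a b {x y} → (l ℕ.+ r) ! ≡ C ℕ.* (l ! ℕ.* r !) →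
                fromℕ (l !) * x ≡ fromℕ a → fromℕ (r !) * y ≡ fromℕ b →
                fromℕ ((l ℕ.+ r) !) * (x * y) ≡ fromℕ (a ℕ.* (C ℕ.* b))
  factorial-* l r C a b {x} {y} [l+r]!≡C*l!*r! l!x≡a r!y≡b = begin
    fromℕ ((l ℕ.+ r) !) * (x * y)                ≡⟨ cong (λ n → fromℕ n * (x * y)) [l+r]!≡C*l!*r! ⟩
    fromℕ (C ℕ.* (l ! ℕ.* r !)) * (x * y)        ≡⟨ cong (_* (x * y)) (trans (fromℕ-homo-* C _) (cong (fromℕ C *_) (fromℕ-homo-* (l !) (r !)))) ⟩
    fromℕ C * (fromℕ (l !) * fromℕ (r !)) * (x * y) ≡⟨ rearrange (fromℕ C) (fromℕ (l !)) (fromℕ (r !)) x y ⟩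
    (fromℕ (l !) * x) * (fromℕ C * (fromℕ (r !) * y)) ≡⟨ cong₂ (λ s t → s * (fromℕ C * t)) l!x≡a r!y≡b ⟩
    fromℕ a * (fromℕ C * fromℕ b)                 ≡⟨ trans (fromℕ-homo-* a (C ℕ.* b)) (cong (fromℕ a *_) (fromℕ-homo-* C b)) ⟨
    fromℕ (a ℕ.* (C ℕ.* b))                       ∎
    where
    open ≡-Reasoning
    open +-*-Solver
    rearrange : ∀ c a b x y → c * (a * b) * (x * y) ≡ (a * x) * (c * (b * y))
    rearrange = solve 5 (λ c a b x y → (c :* (a :* b)) :* (x :* y) := (a :* x) :* (c :* (b :* y))) refl

  ⊛-dividedPower : ∀ {X Y} → DividedPowerSeries X → DividedPowerSeries Y → DividedPowerSeries (X ⊛ Y)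
  ⊛-dividedPower {X} {Y} X-dp Y-dp w =
    *Σℚ-closed IsNatural natural-0 natural-+ (fromℕ (length w !)) (splits w) λ { {u , v} → term }
    where
    term : ∀ {u v} → (u , v) ∈ splits w → IsNatural (fromℕ (length w !) * (X u * Y v))
    term {u} {v} uv∈ with X-dp u | Y-dp v | binomial-factorisation (length u) (length v)
    ... | a , |u|!Xu≡a | b , |v|!Yv≡b | C , [|u|+|v|]!≡C*|u|!*|v|! =
      subst (λ n → IsNatural (fromℕ (n !) * (X u * Y v))) (splits-length w uv∈)
        (a ℕ.* (C ℕ.* b) , factorial-* (length u) (length v) C a b [|u|+|v|]!≡C*|u|!*|v|! |u|!Xu≡a |v|!Yv≡b)

  KummerSeries : ℕ → Series → Set
  KummerSeries j Y = ∀ w → KummerNatural j (length w) (fromℕ (length w !) * Y w)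

  oneS-kummer : KummerSeries 0 oneS
  oneS-kummer []      = 1 , refl , kummerBound-1
  oneS-kummer (_ ∷ w) = subst (KummerNatural 0 (suc (length w))) (sym (*-zeroʳ (fromℕ (suc (length w) !)))) kummerNatural-0

  ⊛-kummer : ∀ {X Y j} → DividedPowerSeries X → X [] ≡ 0ℚ → KummerSeries j Y → KummerSeries (suc j) (X ⊛ Y)
  ⊛-kummer {X} {Y} {j} X-dp X[]≡0 Y-kummer w =
    *Σℚ-closed (KummerNatural (suc j) (length w)) kummerNatural-0 kummerNatural-+ (fromℕ (length w !)) (splits w)
      λ { {u , v} → term }
    where
    term : ∀ {u v} → (u , v) ∈ splits w → KummerNatural (suc j) (length w) (fromℕ (length w !) * (X u * Y v))
    term {[]} {v} _ = subst (KummerNatural (suc j) (length w)) (sym (begin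
      fromℕ (length w !) * (X [] * Y v)  ≡⟨ cong (λ x → fromℕ (length w !) * (x * Y v)) X[]≡0 ⟩
      fromℕ (length w !) * (0ℚ * Y v)    ≡⟨ cong (fromℕ (length w !) *_) (*-zeroˡ (Y v)) ⟩
      fromℕ (length w !) * 0ℚ            ≡⟨ *-zeroʳ (fromℕ (length w !)) ⟩
      0ℚ                                 ∎)) kummerNatural-0
      where open ≡-Reasoning
    term {u@(_ ∷ _)} {v} uv∈ with X-dp u | Y-kummer v | binomial-factorisation (length u) (length v)
    ... | a , |u|!Xu≡a | N , |v|!Yv≡N , bound | C , [|u|+|v|]!≡C*|u|!*|v|! =
      subst (λ n → KummerNatural (suc j) n (fromℕ (n !) * (X u * Y v))) (splits-length w uv∈)
        (a ℕ.* (C ℕ.* N) , factorial-* (length u) (length v) C a N [|u|+|v|]!≡C*|u|!*|v|! |u|!Xu≡a |v|!Yv≡N ,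
         kummerBound-*ˡ a (kummerBound-step {C = C} [|u|+|v|]!≡C*|u|!*|v|! bound))

  powS-kummer : ∀ {X} → DividedPowerSeries X → X [] ≡ 0ℚ → ∀ j → KummerSeries j (powS X j)
  powS-kummer X-dp X[]≡0 zero    = oneS-kummer
  powS-kummer X-dp X[]≡0 (suc j) = ⊛-kummer X-dp X[]≡0 (powS-kummer X-dp X[]≡0 j)

  P : Series
  P = (expS (letterS A) ⊛ expS (letterS B)) ⊖ oneS

  P-dividedPower : DividedPowerSeries P
  P-dividedPower []          = 0 , *-zeroʳ (fromℕ 1)
  P-dividedPower w@(_ ∷ _)   = subst IsNatural (cong (fromℕ (length w !) *_) (sym (+-identityʳ _)))
    (⊛-dividedPower (expS-dividedPower (letterS-natural A)) (expS-dividedPower (letterS-natural B)) w)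

  sgn-integer : ∀ k → IsInteger (sgn k)
  sgn-integer zero    = + 1 , refl
  sgn-integer (suc k) with sgn-integer k
  ... | z , sgn[k]≡z = ℤ.- z , trans (cong -_ sgn[k]≡z) (sym (fromℤ-homo‿- z))

  H-integral : ∀ w → IsInteger (fromℕ (length w ! ℕ.* d (length w)) * H w)
  H-integral w = *Σℚ-closed IsInteger integer-0 integer-+ (fromℕ (n ! ℕ.* d n)) (upTo n) term
    where
    n = length w
    term : ∀ {k} → k ∈ upTo n → IsInteger (fromℕ (n ! ℕ.* d n) * (sgn k * inv (suc k) * powS P (suc k) w))
    term {k} _ with powS-kummer P-dividedPower refl (suc k) w
    ... | N , n!P^[1+k]≡N , bound with kummerBound⇒∣d* bound
    ... | divides Z dn*N≡Z*[1+k] = subst IsInteger (sym (begin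
      fromℕ (n ! ℕ.* d n) * (sgn k * inv (suc k) * X)         ≡⟨ cong (_* (sgn k * inv (suc k) * X)) (fromℕ-homo-* (n !) (d n)) ⟩
      fromℕ (n !) * fromℕ (d n) * (sgn k * inv (suc k) * X)   ≡⟨ rearrange (fromℕ (n !)) (fromℕ (d n)) (sgn k) (inv (suc k)) X ⟩
      sgn k * (fromℕ (d n) * (fromℕ (n !) * X) * inv (suc k)) ≡⟨ cong (λ x → sgn k * (fromℕ (d n) * x * inv (suc k))) n!P^[1+k]≡N ⟩
      sgn k * (fromℕ (d n) * fromℕ N * inv (suc k))          ≡⟨ cong (λ x → sgn k * (x * inv (suc k))) dn*N≡Z*[1+k]′ ⟩
      sgn k * (fromℕ (Z ℕ.* suc k) * inv (suc k))            ≡⟨ cong (sgn k *_) (fromℕ-*-/ Z (suc k)) ⟩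
      sgn k * fromℕ Z                                       ∎))
      (integer-* (sgn-integer k) (+ Z , refl))
      where
      open ≡-Reasoning
      open +-*-Solver
      X = powS P (suc k) w
      dn*N≡Z*[1+k]′ : fromℕ (d n) * fromℕ N ≡ fromℕ (Z ℕ.* suc k)
      dn*N≡Z*[1+k]′ = trans (sym (fromℕ-homo-* (d n) N)) (cong fromℕ dn*N≡Z*[1+k])
      rearrange : ∀ a b s i x → a * b * (s * i * x) ≡ s * (b * (a * x) * i)
      rearrange = solve 5 (λ a b s i x → a :* b :* (s :* i :* x) := s :* (b :* (a :* x) :* i)) refl

  denom-∣ : ∀ D q → IsInteger (fromℕ D * q) → denom q ∣ D
  denom-∣ D q@(mkℚ num den-1 coprime) (z , Dq≡z) =
    coprime-divisor (coprime-sym (recompute-coprime coprime)) (divides ℤ.∣ z ∣ |num|*D≡|z|*den)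
    where
    Dq≃z : mkℚᵘ (+ D) 0 ℚᵘ.* mkℚᵘ num den-1 ≃ mkℚᵘ z 0
    Dq≃z = ℚᵘ.≃-trans (ℚᵘ.≃-sym (ℚᵘ.≃-trans (toℚᵘ-homo-* (fromℕ D) q) (ℚᵘ.*-congʳ (toℚᵘ-fromℤ (+ D)))))
                     (ℚᵘ.≃-trans (toℚᵘ-cong Dq≡z) (toℚᵘ-fromℤ z))
    cross : (+ D ℤ.* num) ℤ.* + 1 ≡ z ℤ.* + (1 ℕ.* suc den-1)
    cross with Dq≃z
    ... | *≡* eq = eq
    |num|*D≡|z|*den : ℤ.∣ num ∣ ℕ.* D ≡ ℤ.∣ z ∣ ℕ.* suc den-1
    |num|*D≡|z|*den = begin
      ℤ.∣ num ∣ ℕ.* D                      ≡⟨ ℕ.*-comm ℤ.∣ num ∣ D ⟩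
      D ℕ.* ℤ.∣ num ∣                      ≡⟨ ℤ.abs-* (+ D) num ⟨
      ℤ.∣ + D ℤ.* num ∣                    ≡⟨ cong ℤ.∣_∣ (ℤ.*-identityʳ (+ D ℤ.* num)) ⟨
      ℤ.∣ (+ D ℤ.* num) ℤ.* + 1 ∣          ≡⟨ cong ℤ.∣_∣ cross ⟩
      ℤ.∣ z ℤ.* + (1 ℕ.* suc den-1) ∣      ≡⟨ ℤ.abs-* z (+ (1 ℕ.* suc den-1)) ⟩
      ℤ.∣ z ∣ ℕ.* (1 ℕ.* suc den-1)        ≡⟨ cong (ℤ.∣ z ∣ ℕ.*_) (ℕ.*-identityˡ (suc den-1)) ⟩
      ℤ.∣ z ∣ ℕ.* suc den-1                ∎
      where open ≡-Reasoning

open import Data.Nat using (ℕ; _*_; _≥_; _!)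
open import Data.Nat.Divisibility using (_∣_)
open import Data.Vec using (Vec; toList)
open import Data.Vec.Properties using (length-toList)
open import Relation.Binary.PropositionalEquality using (subst)
open import Defs
open Coefficients using (denom-∣; H-integral)

theorem1 : (n : ℕ) → n ≥ 1 → (w : Vec Letter n) →
    denom (coeff (toList w) H) ∣ (n !) * d n
theorem1 n _ w = subst (λ m → denom (coeff (toList w) H) ∣ (m !) * d m) (length-toList w)
  (denom-∣ _ (H (toList w)) (H-integral (toList w)))
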